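{- On the category $\mathcal{G}$ of finite graphs there is exactly one model structure whose weak equivalences are the homomorphisms inducing isomorphisms on cores and whose cofibrations are the canonical injections into a coproduct. In this model structure, the acyclic fibrations (the morphisms that are both fibrations and weak equivalences) are exactly the retractions.
   Context: A graph $G=(V_G,E_G)$ is a finite set $V_G$ of vertices together with a symmetric binary relation $E_G$ on $V_G$ (loops are allowed, and there is at most one edge between two vertices). A homomorphism $f:G\to H$ is a map $V_G\to V_H$ such that $(x,y)\in E_G$ implies $(f(x),f(y))\in E_H$. $\mathcal{G}$ is the category whose objects are one chosen representative of each isomorphism class of finite graphs and whose morphisms are homomorphisms; it is finitely complete and finitely cocomplete (the coproduct $A+B$ is the disjoint union; the initial object is the empty graph; the terminal object is the one-vertex graph with a loop). A morphism $r:A\to B$ is a retraction if there is $s:B\to A$ with $r\circ s=1_B$; then $s$ is a section and $B$ is a retract of $A$. The core $G_{core}$ of a graph $G$ is a retract of $G$ with the smallest number of vertices; it is unique up to isomorphism. Fixing a section $s_G:G_{core}\to G$ and a retraction $r_H:H\to H_{core}$, a homomorphism $f:G\to H$ induces the map $f_{core}=r_H\circ f\circ s_G:G_{core}\to H_{core}$; $f$ "induces an isomorphism on cores" if $f_{core}$ is an isomorphism. A canonical injection into a coproduct is a morphism $f:A\to X$ such that there is a graph $B$ and an isomorphism $X\cong A+B$ under which $f$ becomes the coproduct inclusion $A\to A+B$. A morphism $f$ lifts on the left of $g$ (equivalently $g$ lifts on the right of $f$) if every commutative square with $f$ on the left and $g$ on the right admits a diagonal morphism making both triangles commute. A model structure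 on a finitely complete and finitely cocomplete category consists of three classes of morphisms, weak equivalences $W$, cofibrations $C$ and fibrations $F$, each containing the identities and closed under composition, such that: (two-of-three) if two of $f$, $g$, $f\circ g$ are in $W$, so is the third; (lifting) every $i\in C$ lifts on the left of every $p\in F$ whenever $i\in W$ or $p\in W$; (factorization) every morphism factors as $p\circ i$ with $i\in C\cap W$, $p\in F$, and also as $p\circ i$ with $i\in C$, $p\in F\cap W$; (retract) each of $W$, $C$, $F$ is closed under retracts in the category of morphisms. -}

module Defs where

open import Data.Nat using (ℕ; _+_; _≤_)
open import Data.Fin using (Fin; splitAt; _↑ˡ_)
open import Data.Fin.Properties using (splitAt-↑ˡ)
open import Data.Bool using (Bool; true; false)
open import Data.Sum using (_⊎_; inj₁; inj₂)
open import Data.Product using (Σ; _×_; _,_)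
open import Function using (_⇔_)
open import Relation.Binary.PropositionalEquality using (_≡_; refl)

-- Finite graphs: vertex set Fin V, symmetric edge relation (loops allowed,
-- at most one edge between two vertices), given as a Bool-valued relation.

record Graph : Set where
  field
    V    : ℕ
    E    : Fin V → Fin V → Bool
    Esym : ∀ x y → E x y ≡ E y x
open Graph public

record Hom (G H : Graph) : Set where
  field
    map      : Fin (V G) → Fin (V H)
    preserve : ∀ x y → E G x y ≡ true → E H (map x) (map y) ≡ true
open Hom public

idH : ∀ {G} → Hom G G
idH = record { map = λ x → x ; preserve = λ x y e → e }

infixr 9 _∘H_
_∘H_ : ∀ {A B C} → Hom B C → Hom A B → Hom A C
g ∘H f = record { map = λ x → map g (map f x)
                ; preserve = λ x y e → preserve g _ _ (preserve f x y e) }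

infix 4 _≈H_
_≈H_ : ∀ {A B} → Hom A B → Hom A B → Set
f ≈H g = ∀ x → map f x ≡ map g x

IsIso : ∀ {A B} → Hom A B → Set
IsIso {A} {B} f = Σ (Hom B A) λ g → (g ∘H f ≈H idH) × (f ∘H g ≈H idH)

IsRetraction : ∀ {A B} → Hom A B → Set
IsRetraction {A} {B} r = Σ (Hom B A) λ s → r ∘H s ≈H idH

private
  E⊎ : ∀ {m n} → (Fin m → Fin m → Bool) → (Fin n → Fin n → Bool)
     → Fin m ⊎ Fin n → Fin m ⊎ Fin n → Bool
  E⊎ EA EB (inj₁ a) (inj₁ a') = EA a a'
  E⊎ EA EB (inj₂ b) (inj₂ b') = EB b b'
  E⊎ EA EB (inj₁ _) (inj₂ _)  = false
  E⊎ EA EB (inj₂ _) (inj₁ _)  = false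

  E⊎sym : ∀ {m n} (EA : Fin m → Fin m → Bool) (EB : Fin n → Fin n → Bool)
        → (∀ x y → EA x y ≡ EA y x) → (∀ x y → EB x y ≡ EB y x)
        → ∀ u v → E⊎ EA EB u v ≡ E⊎ EA EB v u
  E⊎sym EA EB sA sB (inj₁ a) (inj₁ a') = sA a a'
  E⊎sym EA EB sA sB (inj₂ b) (inj₂ b') = sB b b'
  E⊎sym EA EB sA sB (inj₁ _) (inj₂ _)  = refl
  E⊎sym EA EB sA sB (inj₂ _) (inj₁ _)  = refl

infixr 6 _⊕_
_⊕_ : Graph → Graph → Graph
A ⊕ B = record
  { V    = V A + V B
  ; E    = λ x y → E⊎ (E A) (E B) (splitAt (V A) x) (splitAt (V A) y)
  ; Esym = λ x y → E⊎sym (E A) (E B) (Esym A) (Esym B)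
                     (splitAt (V A) x) (splitAt (V A) y)
  }

inlH : ∀ {A B} → Hom A (A ⊕ B)
inlH {A} {B} = record
  { map      = λ a → a ↑ˡ V B
  ; preserve = pres
  }
  where
  pres : ∀ x y → E A x y ≡ true → E (A ⊕ B) (x ↑ˡ V B) (y ↑ˡ V B) ≡ true
  pres x y e rewrite splitAt-↑ˡ (V A) x (V B) | splitAt-↑ˡ (V A) y (V B) = e

record CoreData (G : Graph) : Set where
  field
    core    : Graph
    sec     : Hom core G
    ret     : Hom G core
    ret∘sec : ret ∘H sec ≈H idH
    minimal : ∀ (K : Graph) (s : Hom K G) (r : Hom G K) → r ∘H s ≈H idH
            → V core ≤ V K
open CoreData public

MorClass : Set₁
MorClass = ∀ {A B : Graph} → Hom A B → Set

-- Weak equivalences: f induces an isomorphism on cores, i.e. for the chosen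
-- cores (section s_G, retraction r_H), r_H ∘ f ∘ s_G is an isomorphism.
WeakEq : MorClass
WeakEq {G} {H} f =
  Σ (CoreData G) λ cG → Σ (CoreData H) λ cH → IsIso (ret cH ∘H f ∘H sec cG)

CanonicalInjection : MorClass
CanonicalInjection {A} {X} f =
  Σ Graph λ B → Σ (Hom X (A ⊕ B)) λ φ → IsIso φ × (φ ∘H f ≈H inlH)

LiftsLeft : ∀ {A B X Y} → Hom A B → Hom X Y → Set
LiftsLeft {A} {B} {X} {Y} f g =
  ∀ (u : Hom A X) (v : Hom B Y) → g ∘H u ≈H v ∘H f →
  Σ (Hom B X) λ d → (d ∘H f ≈H u) × (g ∘H d ≈H v)

IsRetractOf : ∀ {A B C D} → Hom A B → Hom C D → Set
IsRetractOf {A} {B} {C} {D} f g =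
  Σ (Hom A C) λ i → Σ (Hom C A) λ r → Σ (Hom B D) λ i' → Σ (Hom D B) λ r' →
    (r ∘H i ≈H idH) × (r' ∘H i' ≈H idH) ×
    (g ∘H i ≈H i' ∘H f) × (f ∘H r ≈H r' ∘H g)

ContainsIds : MorClass → Set
ContainsIds K = ∀ {A} → K (idH {A})

ClosedComp : MorClass → Set
ClosedComp K = ∀ {A B C} {f : Hom A B} {g : Hom B C} → K f → K g → K (g ∘H f)

ClosedRetracts : MorClass → Set
ClosedRetracts K = ∀ {A B C D} {f : Hom A B} {g : Hom C D}
                 → IsRetractOf f g → K g → K f

record IsModelStructure (W C F : MorClass) : Set where
  field
    W-id   : ContainsIds W
    C-id   : ContainsIds C
    F-id   : ContainsIds F
    W-comp : ClosedComp W
    C-comp : ClosedComp C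
    F-comp : ClosedComp F
    two-of-three₁ : ∀ {A B D} {f : Hom A B} {g : Hom B D}
                  → W f → W g → W (g ∘H f)
    two-of-three₂ : ∀ {A B D} {f : Hom A B} {g : Hom B D}
                  → W f → W (g ∘H f) → W g
    two-of-three₃ : ∀ {A B D} {f : Hom A B} {g : Hom B D}
                  → W g → W (g ∘H f) → W f
    lift-acyclicCof : ∀ {A B X Y} {i : Hom A B} {p : Hom X Y}
                    → C i → W i → F p → LiftsLeft i p
    lift-acyclicFib : ∀ {A B X Y} {i : Hom A B} {p : Hom X Y}
                    → C i → F p → W p → LiftsLeft i p
    factor-acyclicCof : ∀ {A B} (f : Hom A B) →
      Σ Graph λ K → Σ (Hom A K) λ i → Σ (Hom K B) λ p →
        (p ∘H i ≈H f) × C i × W i × F p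
    factor-acyclicFib : ∀ {A B} (f : Hom A B) →
      Σ Graph λ K → Σ (Hom A K) λ i → Σ (Hom K B) λ p →
        (p ∘H i ≈H f) × C i × F p × W p
    W-retract : ClosedRetracts W
    C-retract : ClosedRetracts C
    F-retract : ClosedRetracts F

module Submission where

-- Then fibrations are defined as the maps p : X → Y along which every v : Z → Y
-- lifts once Z maps to X.  Lifting against A → A ⊕ Q only concerns Q, which
-- gives both lifting axioms; factorizations go through A ⊕ (A ⊗ B) and A ⊕ B.
-- Uniqueness holds since X → X ⊕ Z is an acyclic cofibration whenever Z maps
-- to X, and acyclic fibrations are retractions because Y maps back to X.

open import Defs
open import Data.Nat using (ℕ; zero; suc; _+_; _*_; _∸_; _^_; _<_; s≤s)
import Data.Nat.Properties as ℕP
open import Data.Nat.GeneralisedArithmetic using (fold; fold-+)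
open import Data.Fin using (Fin; zero; suc; splitAt; _↑ˡ_; _↑ʳ_; toℕ; funToFin; finToFun; combine; remQuot)
import Data.Fin.Properties as FinP
open import Data.Bool using (true; false; _∧_)
import Data.Bool.Properties as BoolP
open import Data.Sum using (_⊎_; inj₁; inj₂; [_,_]′)
open import Data.Product using (Σ; _×_; _,_; proj₁; proj₂; uncurry)
open import Data.Empty using (⊥-elim)
open import Function using (_⇔_; mk⇔; _∘_)
open import Relation.Nullary using (¬_; Dec; yes; no)
open import Relation.Nullary.Decidable using (_×-dec_; _→-dec_; map′)
open import Relation.Unary using (Decidable)
open import Relation.Binary.PropositionalEquality

iter : ∀ {A : Set} → (A → A) → ℕ → A → A
iter f n x = fold x f n

iter-+ : ∀ {A : Set} (f : A → A) m n x → iter f (m + n) x ≡ iter f m (iter f n x)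
iter-+ f m n x = fold-+ x f m

iter-suc : ∀ {A : Set} (f : A → A) n x → iter f n (f x) ≡ iter f (suc n) x
iter-suc f n x = trans (sym (fold-+ x f n)) (cong (fold x f) (ℕP.+-comm n 1))

-- If f^(D + a) = f^a for a period D = 1 + d, then f^((1 + a) · D) is
-- idempotent: it is a multiple of the period lying beyond the offset a.
periodic⇒idempotent : ∀ {A : Set} (f : A → A) a d →
  (∀ x → iter f (suc d + a) x ≡ iter f a x) →
  ∀ x → iter f (suc a * suc d) (iter f (suc a * suc d) x) ≡ iter f (suc a * suc d) x
periodic⇒idempotent f a d period x = begin
    iter f N (iter f N x)        ≡⟨ sym (iter-+ f N N x) ⟩
    iter f (N + N) x             ≡⟨ cong (λ k → iter f (k + N) x) (sym c+a≡N) ⟩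
    iter f ((c + a) + N) x       ≡⟨ cong (λ k → iter f k x) (ℕP.+-assoc c a N) ⟩
    iter f (c + (a + N)) x       ≡⟨ iter-+ f c (a + N) x ⟩
    iter f c (iter f (a + N) x)  ≡⟨ cong (λ k → iter f c (iter f k x)) (ℕP.+-comm a N) ⟩
    iter f c (iter f (N + a) x)  ≡⟨ cong (iter f c) (periodic (suc a) x) ⟩
    iter f c (iter f a x)        ≡⟨ sym (iter-+ f c a x) ⟩
    iter f (c + a) x             ≡⟨ cong (λ k → iter f k x) c+a≡N ⟩
    iter f N x                   ∎
  where
  open ≡-Reasoning
  D = suc d
  N = suc a * D
  c = N ∸ a
  c+a≡N : c + a ≡ N
  c+a≡N = ℕP.m∸n+n≡m (ℕP.<⇒≤ (ℕP.m≤m*n (suc a) D))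
  periodic : ∀ t y → iter f (t * D + a) y ≡ iter f a y
  periodic zero    y = refl
  periodic (suc t) y = begin
    iter f ((D + t * D) + a) y       ≡⟨ cong (λ k → iter f k y) (ℕP.+-assoc D (t * D) a) ⟩
    iter f (D + (t * D + a)) y       ≡⟨ iter-+ f D (t * D + a) y ⟩
    iter f D (iter f (t * D + a) y)  ≡⟨ cong (iter f D) (periodic t y) ⟩
    iter f D (iter f a y)            ≡⟨ sym (iter-+ f D a y) ⟩
    iter f (D + a) y                 ≡⟨ period y ⟩
    iter f a y                       ∎

-- Every self-map of a finite set has an idempotent positive power: by the
-- pigeonhole principle two iterates coincide, so the iterates are periodic.
idempotentPower : ∀ {k} (f : Fin k → Fin k) →
  Σ ℕ λ M → ∀ x → iter f (suc M) (iter f (suc M) x) ≡ iter f (suc M) x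
idempotentPower {k} f
  with i , j , i<j , same ← FinP.pigeonhole (ℕP.n<1+n (k ^ k)) (λ i → funToFin (iter f (toℕ i)))
  with o , a+o≡b ← ℕP.m≤n⇒∃[o]m+o≡n i<j
  = o + toℕ i * suc o , periodic⇒idempotent f (toℕ i) o period
  where
  iterates-agree : ∀ x → iter f (toℕ i) x ≡ iter f (toℕ j) x
  iterates-agree x = begin
    iter f (toℕ i) x                         ≡⟨ sym (FinP.finToFun-funToFin (iter f (toℕ i)) x) ⟩
    finToFun (funToFin (iter f (toℕ i))) x  ≡⟨ cong (λ c → finToFun c x) same ⟩
    finToFun (funToFin (iter f (toℕ j))) x  ≡⟨ FinP.finToFun-funToFin (iter f (toℕ j)) x ⟩
    iter f (toℕ j) x                         ∎
    where open ≡-Reasoning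
  period : ∀ x → iter f (suc o + toℕ i) x ≡ iter f (toℕ i) x
  period x = sym (trans (iterates-agree x)
                   (cong (λ n → iter f n x) (sym (trans (cong suc (ℕP.+-comm o (toℕ i))) a+o≡b))))

record Enumeration (n : ℕ) (P : Fin n → Set) : Set where
  field
    size      : ℕ
    elem      : Fin size → Fin n
    sound     : ∀ a → P (elem a)
    complete  : ∀ x → P x → Σ (Fin size) λ a → elem a ≡ x
    injective : ∀ a a' → elem a ≡ elem a' → a ≡ a'

enumerate : ∀ {n} {P : Fin n → Set} → Decidable P → Enumeration n P
enumerate {zero} P? = record
  { size = 0 ; elem = λ () ; sound = λ () ; complete = λ () ; injective = λ () }
enumerate {suc n} {P} P? with enumerate (P? ∘ suc) | P? zero
... | rest | no ¬P0 = record
  { size      = size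
  ; elem      = suc ∘ elem
  ; sound     = sound
  ; complete  = complete′
  ; injective = λ a a' e → injective a a' (FinP.suc-injective e) }
  where
  open Enumeration rest
  complete′ : ∀ x → P x → Σ (Fin size) λ a → suc (elem a) ≡ x
  complete′ zero    P0 = ⊥-elim (¬P0 P0)
  complete′ (suc x) Px = let a , e = complete x Px in a , cong suc e
... | rest | yes P0 = record
  { size = suc size ; elem = elem′ ; sound = sound′ ; complete = complete′ ; injective = injective′ }
  where
  open Enumeration rest
  elem′ : Fin (suc size) → Fin (suc n)
  elem′ zero    = zero
  elem′ (suc a) = suc (elem a)
  sound′ : ∀ a → P (elem′ a)
  sound′ zero    = P0
  sound′ (suc a) = sound a
  complete′ : ∀ x → P x → Σ (Fin (suc size)) λ a → elem′ a ≡ x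
  complete′ zero    _  = zero , refl
  complete′ (suc x) Px = let a , e = complete x Px in suc a , cong suc e
  injective′ : ∀ a a' → elem′ a ≡ elem′ a' → a ≡ a'
  injective′ zero    zero     _ = refl
  injective′ (suc a) (suc a') e = cong suc (injective a a' (FinP.suc-injective e))

missing⇒< : ∀ {m n} (s : Fin m → Fin n) → (∀ a a' → s a ≡ s a' → a ≡ a') →
            (x : Fin n) → (∀ a → s a ≢ x) → m < n
missing⇒< {n = suc n} s inj x missed =
  s≤s (FinP.injective⇒≤ (λ {a} {a'} e →
    inj a a' (FinP.punchOut-injective (missed a ∘ sym) (missed a' ∘ sym) e)))

induced : (G : Graph) {m : ℕ} → (Fin m → Fin (V G)) → Graph
induced G {m} s = record
  { V = m ; E = λ a b → E G (s a) (s b) ; Esym = λ a b → Esym G (s a) (s b) }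

inclusion : ∀ {G m} (s : Fin m → Fin (V G)) → Hom (induced G s) G
inclusion s = record { map = s ; preserve = λ a b e → e }

edge-cong : ∀ G {x x' y y'} → x ≡ x' → y ≡ y' → E G x y ≡ true → E G x' y' ≡ true
edge-cong G refl refl e = e

data Side (m n : ℕ) (x : Fin (m + n)) : Set where
  left  : (a : Fin m) → a ↑ˡ n ≡ x → Side m n x
  right : (b : Fin n) → m ↑ʳ b ≡ x → Side m n x

side : ∀ m n x → Side m n x
side m n x with splitAt m x in eq
... | inj₁ a = left a (FinP.splitAt⁻¹-↑ˡ eq)
... | inj₂ b = right b (FinP.splitAt⁻¹-↑ʳ eq)

sides-disjoint : ∀ m n (a : Fin m) (b : Fin n) → a ↑ˡ n ≢ m ↑ʳ b
sides-disjoint m n a b e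
  with () ← trans (sym (FinP.splitAt-↑ˡ m a n)) (trans (cong (splitAt m) e) (FinP.splitAt-↑ʳ m n b))

module _ (A B : Graph) where
  E-inl-inl : ∀ a a' → E (A ⊕ B) (a ↑ˡ V B) (a' ↑ˡ V B) ≡ E A a a'
  E-inl-inl a a' rewrite FinP.splitAt-↑ˡ (V A) a (V B) | FinP.splitAt-↑ˡ (V A) a' (V B) = refl

  E-inr-inr : ∀ b b' → E (A ⊕ B) (V A ↑ʳ b) (V A ↑ʳ b') ≡ E B b b'
  E-inr-inr b b' rewrite FinP.splitAt-↑ʳ (V A) (V B) b | FinP.splitAt-↑ʳ (V A) (V B) b' = refl

  E-inl-inr : ∀ a b → E (A ⊕ B) (a ↑ˡ V B) (V A ↑ʳ b) ≡ false
  E-inl-inr a b rewrite FinP.splitAt-↑ˡ (V A) a (V B) | FinP.splitAt-↑ʳ (V A) (V B) b = refl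

  no-edge-across : ∀ a b → E (A ⊕ B) (a ↑ˡ V B) (V A ↑ʳ b) ≢ true
  no-edge-across a b e with () ← trans (sym (E-inl-inr a b)) e

inrH : ∀ {A B} → Hom B (A ⊕ B)
inrH {A} {B} = record { map = V A ↑ʳ_ ; preserve = λ b b' e → trans (E-inr-inr A B b b') e }

copair : ∀ {A B X} → Hom A X → Hom B X → Hom (A ⊕ B) X
copair {A} {B} {X} f g = record { map = h ; preserve = preserves }
  where
  h : Fin (V A + V B) → Fin (V X)
  h = [ map f , map g ]′ ∘ splitAt (V A)
  preserves : ∀ x y → E (A ⊕ B) x y ≡ true → E X (h x) (h y) ≡ true
  preserves x y e with side (V A) (V B) x | side (V A) (V B) y
  ... | left a refl | left a' refl
    rewrite FinP.splitAt-↑ˡ (V A) a (V B) | FinP.splitAt-↑ˡ (V A) a' (V B) = preserve f a a' e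
  ... | right b refl | right b' refl
    rewrite FinP.splitAt-↑ʳ (V A) (V B) b | FinP.splitAt-↑ʳ (V A) (V B) b' = preserve g b b' e
  ... | left a refl | right b refl = ⊥-elim (no-edge-across A B a b e)
  ... | right b refl | left a refl = ⊥-elim (no-edge-across A B a b (trans (Esym (A ⊕ B) _ _) e))

copair-inl : ∀ {A B X} (f : Hom A X) (g : Hom B X) → copair f g ∘H inlH ≈H f
copair-inl {A} {B} f g a = cong [ map f , map g ]′ (FinP.splitAt-↑ˡ (V A) a (V B))

copair-inr : ∀ {A B X} (f : Hom A X) (g : Hom B X) → copair f g ∘H inrH ≈H g
copair-inr {A} {B} f g b = cong [ map f , map g ]′ (FinP.splitAt-↑ʳ (V A) (V B) b)

Image : ∀ {A B} → Hom A B → Fin (V B) → Set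
Image {A} f y = Σ (Fin (V A)) λ a → map f a ≡ y

-- f embeds A into B as an induced subgraph with decidable image that no
-- edge of B leaves, i.e. as a union of connected components of B.
record ComponentEmbedding {A B : Graph} (f : Hom A B) : Set where
  field
    injective : ∀ a a' → map f a ≡ map f a' → a ≡ a'
    reflects  : ∀ a a' → E B (map f a) (map f a') ≡ true → E A a a' ≡ true
    image?    : ∀ y → Dec (Image f y)
    closed    : ∀ a y → E B (map f a) y ≡ true → Image f y

canonical⇒component : ∀ {A B} (f : Hom A B) → CanonicalInjection f → ComponentEmbedding f
canonical⇒component {A} {B} f (Q , φ , (ψ , ψφ , _) , φf) = record
  { injective = λ a a' e →
      FinP.↑ˡ-injective (V Q) a a' (trans (sym (φf a)) (trans (cong (map φ) e) (φf a')))
  ; reflects  = λ a a' e →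
      trans (sym (E-inl-inl A Q a a')) (edge-cong (A ⊕ Q) (φf a) (φf a') (preserve φ _ _ e))
  ; image?    = image?
  ; closed    = closed
  }
  where
  -- φ is injective, so φ y lands in the A-summand exactly on the image of f.
  from-left : ∀ a y → a ↑ˡ V Q ≡ map φ y → map f a ≡ y
  from-left a y e = trans (sym (ψφ (map f a))) (trans (cong (map ψ) (trans (φf a) e)) (ψφ y))
  not-from-right : ∀ q y → V A ↑ʳ q ≡ map φ y → ¬ Image f y
  not-from-right q y e (a , refl) = sides-disjoint (V A) (V Q) a q (trans (sym (φf a)) (sym e))
  image? : ∀ y → Dec (Image f y)
  image? y with side (V A) (V Q) (map φ y)
  ... | left a e  = yes (a , from-left a y e)
  ... | right q e = no (not-from-right q y e)
  closed : ∀ a y → E B (map f a) y ≡ true → Image f y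
  closed a y e with side (V A) (V Q) (map φ y)
  ... | left a' e'  = a' , from-left a' y e'
  ... | right q e' = ⊥-elim (no-edge-across A Q a q
                       (edge-cong (A ⊕ Q) (φf a) (sym e') (preserve φ _ _ e)))

-- Conversely, a component embedding f : A → B splits B as A ⊕ Q, where Q is
-- induced on the complement of the image of f.
module Splitting {A B : Graph} (f : Hom A B) (emb : ComponentEmbedding f) where
  open ComponentEmbedding emb

  outside? : Decidable (λ y → ¬ Image f y)
  outside? y with image? y
  ... | yes im = no (λ out → out im)
  ... | no out = yes out

  open Enumeration (enumerate outside?) renaming (injective to elem-injective)

  Q : Graph
  Q = induced B elem

  ψ : Hom (A ⊕ Q) B
  ψ = copair f (inclusion elem)

  split : ∀ y → Dec (Image f y) → Fin (V A + size)
  split y (yes (a , _)) = a ↑ˡ size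
  split y (no out)      = V A ↑ʳ proj₁ (complete y out)

  -- Splitting preserves edges because no edge leaves the image of f.
  split-preserves : ∀ y y' (d : Dec (Image f y)) (d' : Dec (Image f y')) →
                    E B y y' ≡ true → E (A ⊕ Q) (split y d) (split y' d') ≡ true
  split-preserves _ _ (yes (a , refl)) (yes (a' , refl)) e = trans (E-inl-inl A Q a a') (reflects a a' e)
  split-preserves _ y' (yes (a , refl)) (no out) e = ⊥-elim (out (closed a y' e))
  split-preserves y _ (no out) (yes (a' , refl)) e = ⊥-elim (out (closed a' y (trans (Esym B _ _) e)))
  split-preserves y y' (no out) (no out') e
    with q , refl ← complete y out | q' , refl ← complete y' out' = trans (E-inr-inr A Q q q') e

  φ : Hom B (A ⊕ Q)
  φ = record { map      = λ y → split y (image? y)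
             ; preserve = λ y y' → split-preserves y y' (image? y) (image? y') }

  ψφ : ψ ∘H φ ≈H idH
  ψφ y = reassemble y (image? y)
    where
    reassemble : ∀ y (d : Dec (Image f y)) → map ψ (split y d) ≡ y
    reassemble y (yes (a , e)) = trans (copair-inl f (inclusion elem) a) e
    reassemble y (no out)      = trans (copair-inr f (inclusion elem) _) (proj₂ (complete y out))

  φf : φ ∘H f ≈H inlH
  φf a = split-image a (image? (map f a))
    where
    split-image : ∀ a (d : Dec (Image f (map f a))) → split (map f a) d ≡ a ↑ˡ size
    split-image a (yes (a' , e)) = cong (_↑ˡ size) (injective a' a e)
    split-image a (no out)       = ⊥-elim (out (a , refl))

  φψ : φ ∘H ψ ≈H idH
  φψ x with side (V A) size x
  ... | left a refl  = trans (cong (map φ) (copair-inl f (inclusion elem) a)) (φf a)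
  ... | right q refl = trans (cong (map φ) (copair-inr f (inclusion elem) q)) (split-elem q (image? (elem q)))
    where
    split-elem : ∀ q (d : Dec (Image f (elem q))) → split (elem q) d ≡ V A ↑ʳ q
    split-elem q (yes im) = ⊥-elim (sound q im)
    split-elem q (no out) = cong (V A ↑ʳ_) (elem-injective _ q (proj₂ (complete (elem q) out)))

component⇒canonical : ∀ {A B} (f : Hom A B) → ComponentEmbedding f → CanonicalInjection f
component⇒canonical f emb = Q , φ , (ψ , ψφ , φψ) , φf
  where open Splitting f emb

component-id : ∀ {A} → ComponentEmbedding (idH {A})
component-id = record
  { injective = λ _ _ e → e ; reflects = λ _ _ e → e
  ; image? = λ y → yes (y , refl) ; closed = λ _ y _ → y , refl }

component-comp : ∀ {A B D} {f : Hom A B} {g : Hom B D} →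
                 ComponentEmbedding f → ComponentEmbedding g → ComponentEmbedding (g ∘H f)
component-comp {D = D} {f = f} {g} ef eg = record
  { injective = λ a a' e → F.injective a a' (G.injective _ _ e)
  ; reflects  = λ a a' e → F.reflects a a' (G.reflects _ _ e)
  ; image?    = image?
  ; closed    = closed
  }
  where
  module F = ComponentEmbedding ef
  module G = ComponentEmbedding eg
  image? : ∀ z → Dec (Image (g ∘H f) z)
  image? z with G.image? z
  ... | no ∉g = no λ (a , e) → ∉g (map f a , e)
  ... | yes (b , refl) with F.image? b
  ...   | yes (a , refl) = yes (a , refl)
  ...   | no ∉f = no λ (a , e) → ∉f (a , G.injective _ _ e)
  closed : ∀ a z → E D (map g (map f a)) z ≡ true → Image (g ∘H f) z
  closed a z e with G.closed (map f a) z e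
  ... | b , refl with F.closed a b (G.reflects _ _ e)
  ...   | a' , refl = a' , refl

component-retract : ∀ {A B C D} {f : Hom A B} {g : Hom C D} →
                    IsRetractOf f g → ComponentEmbedding g → ComponentEmbedding f
component-retract {A} {B} {C} {D} {f} {g} (i , r , i' , r' , ri , r'i' , gi , fr) eg = record
  { injective = λ a a' e → trans (sym (ri a)) (trans (cong (map r)
      (G.injective _ _ (trans (gi a) (trans (cong (map i') e) (sym (gi a')))))) (ri a'))
  ; reflects  = λ a a' e → edge-cong A (ri a) (ri a') (preserve r _ _ (G.reflects _ _
      (edge-cong D (sym (gi a)) (sym (gi a')) (preserve i' _ _ e))))
  ; image?    = image?
  ; closed    = closed
  }
  where
  module G = ComponentEmbedding eg
  pull : ∀ y → Image g (map i' y) → Image f y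
  pull y (c , e) = map r c , trans (fr c) (trans (cong (map r') e) (r'i' y))
  image? : ∀ y → Dec (Image f y)
  image? y with G.image? (map i' y)
  ... | yes im = yes (pull y im)
  ... | no ∉g  = no λ (a , e) → ∉g (map i a , trans (gi a) (cong (map i') e))
  closed : ∀ a y → E B (map f a) y ≡ true → Image f y
  closed a y e = pull y (G.closed (map i a) (map i' y) (edge-cong D (sym (gi a)) refl (preserve i' _ _ e)))

cofibration-inl : ∀ {A B} → CanonicalInjection (inlH {A} {B})
cofibration-inl {B = B} = B , idH , (idH , (λ _ → refl) , (λ _ → refl)) , (λ _ → refl)

anyFunction? : ∀ {a b} {P : (Fin a → Fin b) → Set} →
  (∀ {f g} → (∀ x → f x ≡ g x) → P f → P g) → (∀ f → Dec (P f)) → Dec (Σ (Fin a → Fin b) P)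
anyFunction? {P = P} respects P? = map′
  (λ (c , p) → finToFun c , p)
  (λ (f , p) → funToFin f , respects (λ x → sym (FinP.finToFun-funToFin f x)) p)
  (FinP.any? (P? ∘ finToFun))

IsRetractPair : ∀ G {k} → (Fin k → Fin (V G)) → (Fin (V G) → Fin k) → Set
IsRetractPair G s r =
  (∀ a → r (s a) ≡ a) × (∀ x y → E G x y ≡ true → E G (s (r x)) (s (r y)) ≡ true)

RetractOfSize : Graph → ℕ → Set
RetractOfSize G k = Σ (Fin k → Fin (V G)) λ s → Σ (Fin (V G) → Fin k) λ r → IsRetractPair G s r

retractOfSize? : ∀ G k → Dec (RetractOfSize G k)
retractOfSize? G k = anyFunction? respects-s (λ s → anyFunction? (respects-r s) (pair? s))
  where
  pair? : ∀ s r → Dec (IsRetractPair G s r)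
  pair? s r = FinP.all? (λ a → r (s a) FinP.≟ a)
        ×-dec FinP.all? (λ x → FinP.all? (λ y →
                (E G x y BoolP.≟ true) →-dec (E G (s (r x)) (s (r y)) BoolP.≟ true)))
  respects-r : ∀ s {r r'} → (∀ x → r x ≡ r' x) → IsRetractPair G s r → IsRetractPair G s r'
  respects-r s r≗r' (rs , pres) =
    (λ a → trans (sym (r≗r' (s a))) (rs a)) ,
    (λ x y e → edge-cong G (cong s (r≗r' x)) (cong s (r≗r' y)) (pres x y e))
  respects-s : ∀ {s s'} → (∀ a → s a ≡ s' a) → Σ _ (IsRetractPair G s) → Σ _ (IsRetractPair G s')
  respects-s s≗s' (r , rs , pres) =
    r , (λ a → trans (cong r (sym (s≗s' a))) (rs a)) ,
    (λ x y e → edge-cong G (s≗s' (r x)) (s≗s' (r y)) (pres x y e))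

leastWitness : ∀ {P : ℕ → Set} → (∀ k → Dec (P k)) → ∀ {n} → P n →
               Σ ℕ λ k → P k × (∀ j → j < k → ¬ P j)
leastWitness {P} P? {n} Pn =
  [ (λ least → least) , (λ none → ⊥-elim (none n (ℕP.n<1+n n) Pn)) ]′ (searchBelow (suc n))
  where
  searchBelow : ∀ b → (Σ ℕ λ k → P k × (∀ j → j < k → ¬ P j)) ⊎ (∀ j → j < b → ¬ P j)
  searchBelow zero = inj₂ (λ _ ())
  searchBelow (suc b) with searchBelow b
  ... | inj₁ least = inj₁ least
  ... | inj₂ none with P? b
  ...   | yes Pb = inj₁ (b , Pb , none)
  ...   | no ¬Pb = inj₂ λ j j<1+b → [ none j , (λ { refl → ¬Pb }) ]′ (ℕP.m<1+n⇒m<n∨m≡n j<1+b)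

coreData : (G : Graph) → CoreData G
coreData G
  with k , (s , r , rs , pres) , smaller-impossible
       ← leastWitness (retractOfSize? G) ((λ x → x) , (λ x → x) , (λ _ → refl) , (λ _ _ e → e))
  = record
  { core    = induced G s
  ; sec     = inclusion s
  ; ret     = record { map = r ; preserve = pres }
  ; ret∘sec = rs
  ; minimal = λ K s' r' r's' → ℕP.≮⇒≥ λ V<k → smaller-impossible (V K) V<k
      (map s' , map r' , r's' , λ x y e → preserve s' _ _ (preserve r' x y e))
  }

power : ∀ {K} → ℕ → Hom K K → Hom K K
power {K} n e = record { map = iter (map e) n ; preserve = preserves n }
  where
  preserves : ∀ n x y → E K x y ≡ true → E K (iter (map e) n x) (iter (map e) n y) ≡ true
  preserves zero    x y xy = xy
  preserves (suc n) x y xy = preserve e _ _ (preserves n x y xy)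

fixed? : ∀ {K} (p : Hom K K) → Decidable (λ x → map p x ≡ x)
fixed? p x = map p x FinP.≟ x

-- An idempotent endomorphism of a core fixes every vertex: otherwise its
-- fixed points would induce a retract of G with fewer vertices than the core.
idempotent-fixes : ∀ {G} (cd : CoreData G) (p : Hom (core cd) (core cd)) →
                   (∀ x → map p (map p x) ≡ map p x) → ∀ x → map p x ≡ x
idempotent-fixes cd p idem with FinP.all? (fixed? p)
... | yes all-fixed = all-fixed
... | no ¬all-fixed =
  ⊥-elim (ℕP.<⇒≱ smaller (minimal cd R (sec cd ∘H inclusion elem) (onto ∘H ret cd) retracts))
  where
  K = core cd
  open Enumeration (enumerate (fixed? p))
  R = induced K elem
  index : ∀ x → Σ (Fin size) λ a → elem a ≡ map p x
  index x = complete (map p x) (idem x)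
  onto : Hom K R
  onto = record
    { map = proj₁ ∘ index
    ; preserve = λ x y e →
        edge-cong K (sym (proj₂ (index x))) (sym (proj₂ (index y))) (preserve p x y e) }
  retracts : (onto ∘H ret cd) ∘H (sec cd ∘H inclusion elem) ≈H idH
  retracts a = injective _ a (begin
      elem (proj₁ (index (map (ret cd) (map (sec cd) (elem a))))) ≡⟨ proj₂ (index _) ⟩
      map p (map (ret cd) (map (sec cd) (elem a)))                ≡⟨ cong (map p) (ret∘sec cd (elem a)) ⟩
      map p (elem a)                                              ≡⟨ sound a ⟩
      elem a                                                      ∎)
    where open ≡-Reasoning
  smaller : size < V K
  smaller with x , moved ← FinP.¬∀⟶∃¬ (V K) _ (fixed? p) ¬all-fixed
    = missing⇒< elem injective x (λ a e → moved (subst (λ y → map p y ≡ y) e (sound a)))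

-- Rigidity: every endomorphism of a core is an automorphism, with inverse a
-- power of itself.
core-rigid : ∀ {G} (cd : CoreData G) (e : Hom (core cd) (core cd)) → IsIso e
core-rigid cd e with M , idem ← idempotentPower (map e) =
  power M e , (λ x → trans (iter-suc (map e) M x) (fixes x)) , fixes
  where
  fixes : ∀ x → iter (map e) (suc M) x ≡ x
  fixes = idempotent-fixes cd (power (suc M) e) idem

iso-of-roundTrips : ∀ {X Y} (φ : Hom X Y) (ψ : Hom Y X) →
                    IsIso (ψ ∘H φ) → IsIso (φ ∘H ψ) → IsIso φ
iso-of-roundTrips φ ψ (α , αψφ , ψφα) (β , βφψ , _) = α ∘H ψ , αψφ , φαψ
  where
  open ≡-Reasoning
  φαψ : φ ∘H α ∘H ψ ≈H idH
  φαψ y = begin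
    map φ (map α (map ψ y))                               ≡⟨ sym (βφψ _) ⟩
    map β (map φ (map ψ (map φ (map α (map ψ y)))))       ≡⟨ cong (map β ∘ map φ) (ψφα (map ψ y)) ⟩
    map β (map φ (map ψ y))                               ≡⟨ βφψ y ⟩
    y                                                     ∎

weakEq⇒back : ∀ {A B} (f : Hom A B) → WeakEq f → Hom B A
weakEq⇒back f (cA , cB , g , _) = sec cA ∘H g ∘H ret cB

-- Conversely, any homomorphism back makes f a weak equivalence: both round
-- trips between the cores are endomorphisms of cores, hence automorphisms.
back⇒weakEq : ∀ {A B} (f : Hom A B) → Hom B A → WeakEq f
back⇒weakEq {A} {B} f h = cA , cB ,
  iso-of-roundTrips φ ψ (core-rigid cA (ψ ∘H φ)) (core-rigid cB (φ ∘H ψ))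
  where
  cA = coreData A
  cB = coreData B
  φ = ret cB ∘H f ∘H sec cA
  ψ = ret cA ∘H h ∘H sec cB

∧-true : ∀ {x y} → x ≡ true → y ≡ true → x ∧ y ≡ true
∧-true refl refl = refl

∧-trueˡ : ∀ {x y} → x ∧ y ≡ true → x ≡ true
∧-trueˡ {true} _ = refl

∧-trueʳ : ∀ {x y} → x ∧ y ≡ true → y ≡ true
∧-trueʳ {true} e = e

infixr 7 _⊗_
_⊗_ : Graph → Graph → Graph
A ⊗ B = record
  { V    = V A * V B
  ; E    = λ x y → E A (proj₁ (remQuot {V A} (V B) x)) (proj₁ (remQuot {V A} (V B) y))
                 ∧ E B (proj₂ (remQuot {V A} (V B) x)) (proj₂ (remQuot {V A} (V B) y))
  ; Esym = λ x y → cong₂ _∧_ (Esym A _ _) (Esym B _ _)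
  }

π₁ : ∀ {A B} → Hom (A ⊗ B) A
π₁ {A} {B} = record { map = proj₁ ∘ remQuot {V A} (V B) ; preserve = λ _ _ → ∧-trueˡ }

π₂ : ∀ {A B} → Hom (A ⊗ B) B
π₂ {A} {B} = record { map = proj₂ ∘ remQuot {V A} (V B) ; preserve = λ _ _ → ∧-trueʳ {E A _ _} }

pair : ∀ {Z A B} → Hom Z A → Hom Z B → Hom Z (A ⊗ B)
pair {Z} {A} {B} f g = record { map = λ z → combine (map f z) (map g z) ; preserve = preserves }
  where
  components : ∀ z → remQuot {V A} (V B) (combine (map f z) (map g z)) ≡ (map f z , map g z)
  components z = FinP.remQuot-combine (map f z) (map g z)
  preserves : ∀ z z' → E Z z z' ≡ true →
              E (A ⊗ B) (combine (map f z) (map g z)) (combine (map f z') (map g z')) ≡ true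
  preserves z z' e = ∧-true
    (edge-cong A (sym (cong proj₁ (components z))) (sym (cong proj₁ (components z'))) (preserve f z z' e))
    (edge-cong B (sym (cong proj₂ (components z))) (sym (cong proj₂ (components z'))) (preserve g z z' e))

π₂-pair : ∀ {Z A B} (f : Hom Z A) (g : Hom Z B) → π₂ {A} {B} ∘H pair f g ≈H g
π₂-pair f g z = cong proj₂ (FinP.remQuot-combine (map f z) (map g z))

Fibration : MorClass
Fibration {X} {Y} p = ∀ (Z : Graph) → Hom Z X → (v : Hom Z Y) → Σ (Hom Z X) λ d → p ∘H d ≈H v

-- Retractions are fibrations (lift through the section) and weak
-- equivalences (the section maps back).
retraction⇒fibration : ∀ {X Y} {p : Hom X Y} → IsRetraction p → Fibration p
retraction⇒fibration (σ , pσ) Z _ v = σ ∘H v , λ z → pσ (map v z)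

retraction⇒weakEq : ∀ {X Y} (p : Hom X Y) → IsRetraction p → WeakEq p
retraction⇒weakEq p (σ , _) = back⇒weakEq p σ

-- An acyclic fibration p : X → Y is a retraction: Y maps back to X since p
-- is a weak equivalence, so the identity of Y lifts along p.
acyclicFibration⇒retraction : ∀ {X Y} {p : Hom X Y} → Fibration p → WeakEq p → IsRetraction p
acyclicFibration⇒retraction {Y = Y} {p} fp wp = fp Y (weakEq⇒back p wp) idH

fibration-comp : ∀ {A B D} {f : Hom A B} {g : Hom B D} → Fibration f → Fibration g → Fibration (g ∘H f)
fibration-comp {f = f} {g} ff fg Z h v
  with d , gd ← fg Z (f ∘H h) v
  with d' , fd' ← ff Z h d
  = d' , λ z → trans (cong (map g) (fd' z)) (gd z)

fibration-retract : ClosedRetracts Fibration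
fibration-retract (i , r , i' , r' , _ , r'i' , _ , fr) fg Z h v
  with d , gd ← fg Z (i ∘H h) (i' ∘H v)
  = r ∘H d , λ z → trans (fr (map d z)) (trans (cong (map r') (gd z)) (r'i' (map v z)))

-- Lifting against a coproduct inclusion A → A ⊕ Q only concerns the new
-- summand Q: the lift is u on A and a lift of the bottom map on Q.
inl-liftsLeft : ∀ {A Q X Y} {p : Hom X Y} →
  (∀ (u : Hom A X) (w : Hom Q Y) → Σ (Hom Q X) λ t → p ∘H t ≈H w) → LiftsLeft (inlH {A} {Q}) p
inl-liftsLeft {A} {Q} {p = p} lift u v square with t , pt ← lift u (v ∘H inrH) =
  copair u t , copair-inl u t , lifts
  where
  lifts : p ∘H copair u t ≈H v
  lifts x with side (V A) (V Q) x
  ... | left a refl  = trans (cong (map p) (copair-inl u t a)) (square a)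
  ... | right q refl = trans (cong (map p) (copair-inr u t q)) (pt q)

liftsLeft-transport : ∀ {A B B' X Y} {i : Hom A B} {j : Hom A B'} {p : Hom X Y}
  (φ : Hom B B') (ψ : Hom B' B) → ψ ∘H φ ≈H idH → φ ∘H i ≈H j → LiftsLeft j p → LiftsLeft i p
liftsLeft-transport {i = i} {j} {p} φ ψ ψφ φi lifts-j u v square =
  let d , dj , pd = lifts-j u (v ∘H ψ) (λ a → trans (square a) (cong (map v) (i≈ψj a)))
  in d ∘H φ , (λ a → trans (cong (map d) (φi a)) (dj a)) ,
     (λ x → trans (pd (map φ x)) (cong (map v) (ψφ x)))
  where
  i≈ψj : ∀ a → map i a ≡ map ψ (map j a)
  i≈ψj a = trans (sym (ψφ (map i a))) (cong (map ψ) (φi a))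

complement : ∀ {A B} {i : Hom A B} → CanonicalInjection i → Graph
complement = proj₁

canonical-liftsLeft : ∀ {A B X Y} {i : Hom A B} {p : Hom X Y} (ci : CanonicalInjection i) →
  (∀ (u : Hom A X) (w : Hom (complement {i = i} ci) Y) →
     Σ (Hom (complement {i = i} ci) X) λ t → p ∘H t ≈H w) →
  LiftsLeft i p
canonical-liftsLeft {i = i} {p = p} (Q , φ , (ψ , ψφ , _) , φi) lift =
  liftsLeft-transport {i = i} {j = inlH} {p = p} φ ψ ψφ φi (inl-liftsLeft {p = p} lift)

-- Acyclic cofibrations lift against fibrations: the complement Q maps to X
-- through B → A (i is a weak equivalence) and u.
acyclicCofibration-lifts : ∀ {A B X Y} {i : Hom A B} {p : Hom X Y} →
  CanonicalInjection i → WeakEq i → Fibration p → LiftsLeft i p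
acyclicCofibration-lifts {i = i} {p} ci@(Q , _ , (ψ , _) , _) wi fp =
  canonical-liftsLeft {i = i} {p = p} ci λ u w → fp Q (u ∘H weakEq⇒back i wi ∘H ψ ∘H inrH) w

cofibration-lifts-retraction : ∀ {A B X Y} {i : Hom A B} {p : Hom X Y} →
  CanonicalInjection i → IsRetraction p → LiftsLeft i p
cofibration-lifts-retraction {i = i} {p = p} ci (σ , pσ) =
  canonical-liftsLeft {i = i} {p = p} ci λ u w → σ ∘H w , λ q → pσ (map w q)

-- The inclusion is an acyclic
-- cofibration since the new summand maps back to A, and [f , π₂] is a
-- fibration since anything mapping to A ⊕ (A ⊗ B) and to B maps into A ⊗ B.
factor-acyclicCofibration : ∀ {A B} (f : Hom A B) →
  Σ Graph λ K → Σ (Hom A K) λ i → Σ (Hom K B) λ p →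
    (p ∘H i ≈H f) × CanonicalInjection i × WeakEq i × Fibration p
factor-acyclicCofibration {A} {B} f =
  A ⊕ (A ⊗ B) , inlH , p , copair-inl f (π₂ {A} {B}) , cofibration-inl ,
  back⇒weakEq inlH toA , fibration
  where
  p = copair f (π₂ {A} {B})
  toA : Hom (A ⊕ (A ⊗ B)) A
  toA = copair idH (π₁ {A} {B})
  fibration : Fibration p
  fibration Z h v = inrH ∘H pair (toA ∘H h) v ,
    λ z → trans (copair-inr f (π₂ {A} {B}) _) (π₂-pair (toA ∘H h) v z)

factor-acyclicFibration : ∀ {A B} (f : Hom A B) →
  Σ Graph λ K → Σ (Hom A K) λ i → Σ (Hom K B) λ p →
    (p ∘H i ≈H f) × CanonicalInjection i × Fibration p × WeakEq p
factor-acyclicFibration {A} {B} f =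
  A ⊕ B , inlH , p , copair-inl f idH , cofibration-inl ,
  retraction⇒fibration {p = p} retraction , retraction⇒weakEq p retraction
  where
  p = copair f (idH {B})
  retraction : IsRetraction p
  retraction = inrH , copair-inr f idH

-- Every axiom about weak equivalences reduces to composing homomorphisms
-- back (weakEq⇒back, back⇒weakEq); cofibrations are handled as component
-- embeddings.
fibration-modelStructure : IsModelStructure WeakEq CanonicalInjection Fibration
fibration-modelStructure = record
  { W-id   = back⇒weakEq idH idH
  ; C-id   = component⇒canonical idH component-id
  ; F-id   = λ Z _ v → v , λ _ → refl
  ; W-comp = λ {_} {_} {_} {f} {g} → weakEq-comp {f = f} {g = g}
  ; C-comp = λ {_} {_} {_} {f} {g} cf cg → component⇒canonical (g ∘H f)
      (component-comp (canonical⇒component f cf) (canonical⇒component g cg))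
  ; F-comp = λ {_} {_} {_} {f} {g} → fibration-comp {f = f} {g = g}
  ; two-of-three₁ = λ {_} {_} {_} {f} {g} → weakEq-comp {f = f} {g = g}
  ; two-of-three₂ = λ {_} {_} {_} {f} {g} wf wgf → back⇒weakEq g (f ∘H weakEq⇒back (g ∘H f) wgf)
  ; two-of-three₃ = λ {_} {_} {_} {f} {g} wg wgf → back⇒weakEq f (weakEq⇒back (g ∘H f) wgf ∘H g)
  ; lift-acyclicCof = λ {_} {_} {_} {_} {i} {p} → acyclicCofibration-lifts {i = i} {p = p}
  ; lift-acyclicFib = λ {_} {_} {_} {_} {i} {p} ci fp wp →
      cofibration-lifts-retraction {i = i} {p = p} ci (acyclicFibration⇒retraction {p = p} fp wp)
  ; factor-acyclicCof = factor-acyclicCofibration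
  ; factor-acyclicFib = factor-acyclicFibration
  ; W-retract = λ {_} {_} {_} {_} {f} {g} (_ , r , i' , _) wg →
      back⇒weakEq f (r ∘H weakEq⇒back g wg ∘H i')
  ; C-retract = λ {_} {_} {_} {_} {f} {g} fg cg → component⇒canonical f
      (component-retract fg (canonical⇒component g cg))
  ; F-retract = λ {_} {_} {_} {_} {f} {g} → fibration-retract {f = f} {g = g}
  }
  where
  weakEq-comp : ClosedComp WeakEq
  weakEq-comp {f = f} {g} wf wg = back⇒weakEq (g ∘H f) (weakEq⇒back f wf ∘H weakEq⇒back g wg)

-- In any model structure with these weak equivalences and cofibrations, a
-- fibration p : X → Y is a Fibration: if Z maps to X then inl : X → X ⊕ Z is
-- an acyclic cofibration, and lifting against it factors v : Z → Y through p.
modelFibration⇒fibration : ∀ {F' : MorClass} → IsModelStructure WeakEq CanonicalInjection F' →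
                           ∀ {X Y} {p : Hom X Y} → F' p → Fibration p
modelFibration⇒fibration ms {X} {p = p} Fp Z h v =
  let d , _ , pd = IsModelStructure.lift-acyclicCof ms {i = inlH {X} {Z}} {p = p} cofibration-inl
                     (back⇒weakEq inlH (copair idH h)) Fp idH (copair p v) (λ x → sym (copair-inl p v x))
  in d ∘H inrH , λ z → trans (pd _) (copair-inr p v z)

-- Conversely a Fibration f is a retract of the fibration q in a factorization
-- f = q ∘ i with i an acyclic cofibration: lift f against i.
fibration⇒modelFibration : ∀ {F' : MorClass} → IsModelStructure WeakEq CanonicalInjection F' →
                           ∀ {X Y} {f : Hom X Y} → Fibration f → F' f
fibration⇒modelFibration ms {f = f} ff =
  let _ , i , q , qi , ci , wi , Fq = IsModelStructure.factor-acyclicCof ms f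
      d , di , fd = acyclicCofibration-lifts {i = i} {p = f} ci wi ff idH q (λ a → sym (qi a))
  in IsModelStructure.F-retract ms (i , d , idH , idH , di , (λ _ → refl) , qi , fd) Fq

fibrations-unique : ∀ (F' : MorClass) → IsModelStructure WeakEq CanonicalInjection F' →
                    ∀ {A B} (f : Hom A B) → F' f ⇔ Fibration f
fibrations-unique F' ms f =
  mk⇔ (modelFibration⇒fibration ms {p = f}) (fibration⇒modelFibration ms {f = f})

acyclicFibration⇔retraction : ∀ {A B} (f : Hom A B) → (Fibration f × WeakEq f) ⇔ IsRetraction f
acyclicFibration⇔retraction f =
  mk⇔ (uncurry (acyclicFibration⇒retraction {p = f}))
      (λ retr → retraction⇒fibration {p = f} retr , retraction⇒weakEq f retr)

mainTheorem1 : Σ MorClass λ F →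
                 IsModelStructure WeakEq CanonicalInjection F
                 × (∀ (F' : MorClass) → IsModelStructure WeakEq CanonicalInjection F'
                      → ∀ {A B} (f : Hom A B) → F' f ⇔ F f)
                 × (∀ {A B} (f : Hom A B) → (F f × WeakEq f) ⇔ IsRetraction f)
mainTheorem1 = Fibration , fibration-modelStructure , fibrations-unique , acyclicFibration⇔retraction
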